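{- Let $w\ge 1$ and let $(A\cup B\cup C\cup D,\mathcal B)$ be a Steiner triple system of order $3w+3$, where $A,B,C,D$ are pairwise disjoint, $|A|=|B|=|C|=w$ and $|D|=3$, and suppose $\mathcal B$ contains a sub-TD $(A\cup B\cup C,\{A,B,C\},\mathcal T)$, i.e. a transversal design TD$(3,w)$ with groups $A,B,C$ and block set $\mathcal T\subseteq\mathcal B$. Then $\mathcal B=\mathcal T\cup\mathcal B_A\cup\mathcal B_B\cup\mathcal B_C$, where the supports of $\mathcal B_A,\mathcal B_B,\mathcal B_C$ are $A\cup D$, $B\cup D$, $C\cup D$ respectively, and two of $\mathcal B_A,\mathcal B_B,\mathcal B_C$ are almost-sub-STS with missing triple $D$, while the remaining one is a sub-STS. In particular, $w+3\equiv 1,3 \pmod 6$.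
   Context: A Steiner triple system STS$(v)$ is a pair $(S,\mathcal B)$ with $|S|=v$ and $\mathcal B$ a collection of 3-subsets (blocks) of $S$ such that every two distinct points of $S$ lie in exactly one block. A transversal design TD$(3,w)$ is a triple $(S,\mathcal G,\mathcal B)$ with $|S|=3w$, $\mathcal G$ a partition of $S$ into 3 groups of size $w$, and $\mathcal B$ a set of 3-subsets each meeting every group in exactly one point, such that any two points in different groups lie in exactly one block. Systems are identified with their block sets; a sub-STS (sub-TD) of an STS $\mathcal B$ is a subset of $\mathcal B$ which is itself an STS (TD) on some point set, called its support. A subset $\mathcal C$ of an STS $\mathcal B$ is an almost-sub-STS if $\mathcal C=\mathcal C'\setminus\{T\}$ for some STS $\mathcal C'$ (on some point set, its support) and some triple $T\in\mathcal C'$; $T$ is called the missing triple (it need not be a block of $\mathcal B$). -}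

module Defs where

open import Level using (Level) renaming (suc to lsuc)
open import Data.Nat using (ℕ)
open import Data.Fin using (Fin; zero; suc)
open import Data.Fin.Subset using (Subset; _∈_; _⊆_; _∪_; _∩_; ∣_∣; ⊥)
open import Data.Product using (Σ; ∃; _×_; _,_)
open import Data.Sum using (_⊎_)
open import Relation.Binary.PropositionalEquality using (_≡_; _≢_)

Coll : ℕ → Set₁
Coll n = Subset n → Set

_⊑_ : ∀ {n} → Coll n → Coll n → Set
𝒞 ⊑ 𝒟 = ∀ t → 𝒞 t → 𝒟 t

ExactlyOne : ∀ {n} → Coll n → Fin n → Fin n → Set
ExactlyOne 𝒞 x y =
  (∃ λ t → 𝒞 t × x ∈ t × y ∈ t) ×
  (∀ t t′ → 𝒞 t → 𝒞 t′ → x ∈ t → y ∈ t → x ∈ t′ → y ∈ t′ → t ≡ t′)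

IsSTS : ∀ {n} → Subset n → Coll n → Set
IsSTS S 𝒞 =
  (∀ t → 𝒞 t → ∣ t ∣ ≡ 3 × t ⊆ S) ×
  (∀ x y → x ∈ S → y ∈ S → x ≢ y → ExactlyOne 𝒞 x y)

IsTD3 : ∀ {n} → ℕ → (Fin 3 → Subset n) → Coll n → Set
IsTD3 w G 𝒯 =
  (∀ i → ∣ G i ∣ ≡ w) ×
  (∀ i j → i ≢ j → G i ∩ G j ≡ ⊥) ×
  (∀ t → 𝒯 t → ∣ t ∣ ≡ 3 × t ⊆ (G zero ∪ G (suc zero) ∪ G (suc (suc zero)))
                × (∀ i → ∣ t ∩ G i ∣ ≡ 1)) ×
  (∀ i j → i ≢ j → ∀ x y → x ∈ G i → y ∈ G j → ExactlyOne 𝒯 x y)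

groups : ∀ {n} → Subset n → Subset n → Subset n → Fin 3 → Subset n
groups A B C zero = A
groups A B C (suc zero) = B
groups A B C (suc (suc zero)) = C

SubSTS : ∀ {n} → Coll n → Subset n → Coll n → Set
SubSTS 𝓑 S 𝒞 = 𝒞 ⊑ 𝓑 × IsSTS S 𝒞

-- 𝒞 is an almost-sub-STS of 𝓑 with support S and missing triple T:
-- 𝒞 ⊆ 𝓑 and 𝒞 = 𝒞′ ∖ {T} for some STS 𝒞′ on S containing T
AlmostSubSTS : ∀ {n} → Coll n → Subset n → Subset n → Coll n → Set₁
AlmostSubSTS 𝓑 S T 𝒞 =
  𝒞 ⊑ 𝓑 ×
  Σ (Coll _) λ 𝒞′ → IsSTS S 𝒞′ × 𝒞′ T ×
    (∀ t → (𝒞 t → 𝒞′ t × t ≢ T) × (𝒞′ t × t ≢ T → 𝒞 t))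

IsUnion4 : ∀ {n} → Coll n → Coll n → Coll n → Coll n → Coll n → Set
IsUnion4 𝓑 𝒯 𝒳 𝒴 𝒵 =
  ∀ t → (𝓑 t → 𝒯 t ⊎ 𝒳 t ⊎ 𝒴 t ⊎ 𝒵 t) × (𝒯 t ⊎ 𝒳 t ⊎ 𝒴 t ⊎ 𝒵 t → 𝓑 t)

-- Every block of 𝓑 meeting two groups is a block of 𝒯, and every other block lies in
-- A ∪ D, B ∪ D or C ∪ D. For x in a group G and y ∈ G ∪ D the block through x and y stays
-- inside G ∪ D, since otherwise it would be a transversal block meeting G twice or meeting D;
-- so only the pairs of D can leave G ∪ D. Pairing off the other points through a fixed point
-- shows that an STS has odd order, so w is even. For D = {p, q, r}, sending a point a of a
-- group G to the third point of the block through p and a pairs off the points of G except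
-- those sent to q or r, so the blocks through p, q and through p, r meet G together. Hence all
-- pairs of D are completed inside one G ∪ D (or D is itself a block): that G ∪ D carries a
-- sub-STS, and the other two do once D is added. Its order w + 3 is odd, and 3 divides
-- (w + 3)(w + 2) because rotating the ordered pairs of each block, (x, y) ↦ (y, z) ↦ (z, x),
-- has order 3; so w + 3 ≡ 1, 3 (mod 6).

module Submission where

open import Defs
open import Data.Nat using (ℕ; zero; suc; _≤_; _<_; _+_; _*_; _∸_; _%_; s≤s)
open import Data.Nat.Properties using (+-suc; +-comm; m≤n+m)
open import Data.Nat.Divisibility using (_∣_; divides; _∣0; ∣m∣n⇒∣m+n; ∣m+n∣m⇒∣n; ∣-refl; ∣⇒≤; n∣m*n)
open import Data.Nat.DivMod using (_/_; m%n<n; m≡m%n+[m/n]*n; [m+kn]%n≡m%n)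
open import Data.Nat.Tactic.RingSolver using (solve-∀)
open import Data.Nat.Induction using (<-rec)
open import Data.Bool using (Bool; true; false; _∧_; not; if_then_else_)
import Data.Bool.Properties as Bool
open import Data.Fin using (Fin; zero; suc)
open import Data.Fin.Subset using (Subset; _∈_; _∉_; _⊆_; _∪_; _∩_; ∣_∣; ⊥)
open import Data.Fin.Subset.Properties
  using (_∈?_; ∉⊥; x∈p∩q⁺; x∈p∪q⁺; x∈p∪q⁻; ⊆-antisym; ∩-distribˡ-∪; ∪-idem)
open import Data.Vec using (_∷_; []; lookup)
open import Data.Vec.Properties using ([]=⇒lookup; lookup⇒[]=)
import Data.Vec.Properties as Vec
import Data.Fin.Properties as Fin
open import Data.Product using (Σ; ∃; _×_; _,_; proj₁; proj₂)
import Data.Product.Properties as Product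
open import Data.Sum using (_⊎_; inj₁; inj₂; [_,_]′)
open import Data.Empty using (⊥-elim)
open import Relation.Nullary using (¬_; ¬?; Dec; yes; no; does; _×-dec_)
open import Relation.Nullary.Decidable using (dec-true; dec-false; decidable-stable)
open import Relation.Binary.Definitions using (DecidableEquality)
open import Function using (_∘_; id)
open import Relation.Binary.PropositionalEquality

2∤suc-of-even : ∀ {k} → 2 ∣ k → ¬ 2 ∣ suc k
2∤suc-of-even {k} 2∣k 2∣1+k with ∣⇒≤ (∣m+n∣m⇒∣n (subst (2 ∣_) (+-comm 1 k) 2∣1+k) 2∣k)
... | s≤s ()

3∤2 : ¬ 3 ∣ 2
3∤2 3∣2 with ∣⇒≤ 3∣2
... | s≤s (s≤s ())

suc-even-mod6 : ∀ u → 2 ∣ u → 3 ∣ suc u * u → suc u % 6 ≡ 1 ⊎ suc u % 6 ≡ 3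
suc-even-mod6 _ (divides k refl) 3∣ = by-residue (k % 3) (k / 3) (m%n<n k 3) (m≡m%n+[m/n]*n k 3) 3∣
  where
  by-residue : ∀ s q → s < 3 → k ≡ s + q * 3 → 3 ∣ suc (k * 2) * (k * 2) →
               suc (k * 2) % 6 ≡ 1 ⊎ suc (k * 2) % 6 ≡ 3
  by-residue 0 q _ refl _  = inj₁ (trans (cong (_% 6) (e₀ q)) ([m+kn]%n≡m%n 1 q 6))
    where
    e₀ : ∀ q → suc ((0 + q * 3) * 2) ≡ 1 + q * 6
    e₀ = solve-∀
  by-residue 1 q _ refl _  = inj₂ (trans (cong (_% 6) (e₁ q)) ([m+kn]%n≡m%n 3 q 6))
    where
    e₁ : ∀ q → suc ((1 + q * 3) * 2) ≡ 3 + q * 6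
    e₁ = solve-∀
  by-residue 2 q _ refl 3∣ = ⊥-elim (3∤2 (∣m+n∣m⇒∣n (subst (3 ∣_) (e₂ q) 3∣) (n∣m*n (12 * q * q + 18 * q + 6))))
    where
    e₂ : ∀ q → suc ((2 + q * 3) * 2) * ((2 + q * 3) * 2) ≡ (12 * q * q + 18 * q + 6) * 3 + 2
    e₂ = solve-∀
  by-residue (suc (suc (suc _))) _ (s≤s (s≤s (s≤s ()))) _ _

3w+3≡ : ∀ w → w + (w + (w + 3)) ≡ suc ((w + 1) * 2 + w)
3w+3≡ = solve-∀

-- Counting Boolean predicates

module _ {T : Set} (_≟_ : DecidableEquality T) where

  remove : (T → Bool) → T → T → Bool
  remove f a x = not (does (x ≟ a)) ∧ f x

  remove-self : ∀ f a → remove f a a ≡ false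
  remove-self f a rewrite dec-true (a ≟ a) refl = refl

  remove-other : ∀ f {a x} → x ≢ a → remove f a x ≡ f x
  remove-other f {a} {x} x≢a rewrite dec-false (x ≟ a) x≢a = refl

  remove-true⁺ : ∀ f {a x} → f x ≡ true → x ≢ a → remove f a x ≡ true
  remove-true⁺ f fx x≢a = trans (remove-other f x≢a) fx

  remove-true⁻ : ∀ f {a x} → remove f a x ≡ true → f x ≡ true × x ≢ a
  remove-true⁻ f {a} {x} h with x ≟ a
  ... | no x≢a = h , x≢a

  remove₂-true⁻ : ∀ f {a b x} → remove (remove f a) b x ≡ true → f x ≡ true × x ≢ a × x ≢ b
  remove₂-true⁻ f {a} h
    with fˣ , x≢b ← remove-true⁻ (remove f a) h
    with fx , x≢a ← remove-true⁻ f fˣ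
    = fx , x≢a , x≢b

  remove₂-true⁺ : ∀ f {a b x} → f x ≡ true → x ≢ a → x ≢ b → remove (remove f a) b x ≡ true
  remove₂-true⁺ f {a} fx x≢a x≢b = remove-true⁺ (remove f a) (remove-true⁺ f fx x≢a) x≢b

-- Abstracts over the point type so that the orbit-counting lemmas serve both points and
-- ordered pairs of points.
record Counting (T : Set) : Set where
  field
    _≟_          : DecidableEquality T
    count        : (T → Bool) → ℕ
    count-false  : ∀ {f : T → Bool} → (∀ x → f x ≡ false) → count f ≡ 0
    count-remove : ∀ {f : T → Bool} {a} → f a ≡ true → count f ≡ suc (count (remove _≟_ f a))
    search       : ∀ (f : T → Bool) → (∃ λ a → f a ≡ true) ⊎ (∀ x → f x ≡ false)

module CountingProperties {T : Set} (C : Counting T) where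
  open Counting C

  count-true⇒≢0 : ∀ {f a} → f a ≡ true → count f ≢ 0
  count-true⇒≢0 fa eq with () ← trans (sym (count-remove fa)) eq

  count≡0⇒false : ∀ {f} → count f ≡ 0 → ∀ x → f x ≡ false
  count≡0⇒false {f} eq x with f x in fx
  ... | false = refl
  ... | true  = ⊥-elim (count-true⇒≢0 fx eq)

  count≡suc⇒true : ∀ {f k} → count f ≡ suc k → ∃ λ a → f a ≡ true
  count≡suc⇒true {f} eq with search f
  ... | inj₁ found = found
  ... | inj₂ none with () ← trans (sym (count-false none)) eq

  count-remove₂ : ∀ {f a b} → f a ≡ true → f b ≡ true → b ≢ a →
                  count f ≡ 2 + count (remove _≟_ (remove _≟_ f a) b)
  count-remove₂ {f} fa fb b≢a =
    trans (count-remove fa) (cong suc (count-remove (remove-true⁺ _≟_ f fb b≢a)))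

  count≡3⇒third : ∀ {f x y} → count f ≡ 3 → f x ≡ true → f y ≡ true → x ≢ y →
    ∃ λ z → f z ≡ true × z ≢ x × z ≢ y × (∀ u → f u ≡ true → u ≡ x ⊎ u ≡ y ⊎ u ≡ z)
  count≡3⇒third {f} {x} {y} eq fx fy x≢y = from-rest (count≡suc⇒true rest≡1)
    where
    rest = remove _≟_ (remove _≟_ f x) y
    rest≡1 : count rest ≡ 1
    rest≡1 = cong (_∸ 2) (trans (sym (count-remove₂ fx fy (x≢y ∘ sym))) eq)
    from-rest : (∃ λ z → rest z ≡ true) →
      ∃ λ z → f z ≡ true × z ≢ x × z ≢ y × (∀ u → f u ≡ true → u ≡ x ⊎ u ≡ y ⊎ u ≡ z)
    from-rest (z , rest-z) with fz , z≢x , z≢y ← remove₂-true⁻ _≟_ f rest-z = z , fz , z≢x , z≢y , members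
      where
      rest-without-z≡0 : count (remove _≟_ rest z) ≡ 0
      rest-without-z≡0 = cong (_∸ 1) (trans (sym (count-remove rest-z)) rest≡1)
      members : ∀ u → f u ≡ true → u ≡ x ⊎ u ≡ y ⊎ u ≡ z
      members u fu with u ≟ x | u ≟ y | u ≟ z
      ... | yes u≡x | _       | _       = inj₁ u≡x
      ... | no _    | yes u≡y | _       = inj₂ (inj₁ u≡y)
      ... | no _    | no _    | yes u≡z = inj₂ (inj₂ u≡z)
      ... | no u≢x  | no u≢y  | no u≢z
        with () ← trans (sym (count≡0⇒false rest-without-z≡0 u))
                        (remove-true⁺ _≟_ rest (remove₂-true⁺ _≟_ f fu u≢x u≢y) u≢z)

  divides-count-by-peeling : ∀ k (P : (T → Bool) → Set) →
    (∀ {f a} → P f → f a ≡ true → ∃ λ g → P g × count f ≡ suc k + count g) →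
    ∀ {f} → P f → suc k ∣ count f
  divides-count-by-peeling k P peel {f} Pf = <-rec Q step (count f) f refl Pf
    where
    Q : ℕ → Set
    Q m = ∀ f → count f ≡ m → P f → suc k ∣ m
    step : ∀ m → (∀ {m′} → m′ < m → Q m′) → Q m
    step _ rec f refl Pf with search f
    ... | inj₂ none = subst (suc k ∣_) (sym (count-false none)) (suc k ∣0)
    ... | inj₁ (a , fa) with g , Pg , eq ← peel Pf fa =
      subst (suc k ∣_) (sym eq) (∣m∣n⇒∣m+n ∣-refl (rec smaller g refl Pg))
      where
      smaller : count g < count f
      smaller = subst (count g <_) (sym eq) (s≤s (m≤n+m (count g) k))

  record FreeInvolution (σ : T → T) (f : T → Bool) : Set where
    field
      closed     : ∀ {x} → f x ≡ true → f (σ x) ≡ true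
      involutive : ∀ {x} → f x ≡ true → σ (σ x) ≡ x
      no-fixed   : ∀ {x} → f x ≡ true → σ x ≢ x

  free-involution⇒2∣count : ∀ {σ f} → FreeInvolution σ f → 2 ∣ count f
  free-involution⇒2∣count {σ} = divides-count-by-peeling 1 (FreeInvolution σ) peel
    where
    peel : ∀ {f a} → FreeInvolution σ f → f a ≡ true →
           ∃ λ g → FreeInvolution σ g × count f ≡ 2 + count g
    peel {f} {a} inv fa = remove _≟_ (remove _≟_ f a) (σ a) , inv′ , count-remove₂ fa (closed fa) (no-fixed fa)
      where
      open FreeInvolution inv
      inv′ : FreeInvolution σ (remove _≟_ (remove _≟_ f a) (σ a))
      inv′ = record
        { closed = λ h → let fx , x≢a , x≢σa = remove₂-true⁻ _≟_ f h in
            remove₂-true⁺ _≟_ f (closed fx)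
              (λ σx≡a → x≢σa (trans (sym (involutive fx)) (cong σ σx≡a)))
              (λ σx≡σa → x≢a (trans (sym (involutive fx)) (trans (cong σ σx≡σa) (involutive fa))))
        ; involutive = λ h → involutive (proj₁ (remove₂-true⁻ _≟_ f h))
        ; no-fixed = λ h → no-fixed (proj₁ (remove₂-true⁻ _≟_ f h))
        }

  record FreeOrder3 (σ : T → T) (f : T → Bool) : Set where
    field
      closed     : ∀ {x} → f x ≡ true → f (σ x) ≡ true
      order3     : ∀ {x} → f x ≡ true → σ (σ (σ x)) ≡ x
      no-fixed   : ∀ {x} → f x ≡ true → σ x ≢ x

  free-order3⇒3∣count : ∀ {σ f} → FreeOrder3 σ f → 3 ∣ count f
  free-order3⇒3∣count {σ} = divides-count-by-peeling 2 (FreeOrder3 σ) peel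
    where
    peel : ∀ {f a} → FreeOrder3 σ f → f a ≡ true →
           ∃ λ g → FreeOrder3 σ g × count f ≡ 3 + count g
    peel {f} {a} ord fa = remove _≟_ f₂ c , ord′ , count≡3+
      where
      open FreeOrder3 ord
      b = σ a
      c = σ b
      f₂ = remove _≟_ (remove _≟_ f a) b
      fb = closed fa
      fc = closed fb
      c≢a : c ≢ a
      c≢a c≡a = no-fixed fa (trans (cong σ (sym c≡a)) (order3 fa))
      count≡3+ : count f ≡ 3 + count (remove _≟_ f₂ c)
      count≡3+ = trans (count-remove₂ fa fb (no-fixed fa))
                       (cong (2 +_) (count-remove (remove₂-true⁺ _≟_ f fc c≢a (no-fixed fb))))
      ord′ : FreeOrder3 σ (remove _≟_ f₂ c)
      ord′ = record
        { closed = λ {x} h →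
            let f₂x , x≢c = remove-true⁻ _≟_ f₂ h
                fx , x≢a , x≢b = remove₂-true⁻ _≟_ f f₂x
                back : ∀ {y} → σ x ≡ y → x ≡ σ (σ y)
                back σx≡y = trans (sym (order3 fx)) (cong (λ v → σ (σ v)) σx≡y)
            in remove-true⁺ _≟_ f₂ (remove₂-true⁺ _≟_ f (closed fx)
                 (λ σx≡a → x≢c (back σx≡a))
                 (λ σx≡b → x≢a (trans (back σx≡b) (order3 fa))))
                 (λ σx≡c → x≢b (trans (back σx≡c) (order3 fb)))
        ; order3 = λ h → order3 (proj₁ (remove₂-true⁻ _≟_ f (proj₁ (remove-true⁻ _≟_ f₂ h))))
        ; no-fixed = λ h → no-fixed (proj₁ (remove₂-true⁻ _≟_ f (proj₁ (remove-true⁻ _≟_ f₂ h))))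
        }

countFin : ∀ {n} → (Fin n → Bool) → ℕ
countFin {zero}  f = 0
countFin {suc n} f = (if f zero then suc else id) (countFin (f ∘ suc))

countFin-cong : ∀ {n} {f g : Fin n → Bool} → (∀ x → f x ≡ g x) → countFin f ≡ countFin g
countFin-cong {zero}  eq = refl
countFin-cong {suc n} {f} {g} eq rewrite eq zero = cong (if g zero then suc else id) (countFin-cong (eq ∘ suc))

countFin-false : ∀ {n} {f : Fin n → Bool} → (∀ x → f x ≡ false) → countFin f ≡ 0
countFin-false {zero}  none = refl
countFin-false {suc n} {f} none rewrite none zero = countFin-false (none ∘ suc)

countFin-remove : ∀ {n} {f : Fin n → Bool} {a} → f a ≡ true →
                  countFin f ≡ suc (countFin (remove Fin._≟_ f a))
countFin-remove {suc n} {f} {zero} fa rewrite fa = refl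
countFin-remove {suc n} {f} {suc a} fa with f zero
... | true  = cong suc (countFin-remove {f = f ∘ suc} fa)
... | false = countFin-remove {f = f ∘ suc} fa

searchFin : ∀ {n} (f : Fin n → Bool) → (∃ λ a → f a ≡ true) ⊎ (∀ x → f x ≡ false)
searchFin f with Fin.any? (λ x → f x Bool.≟ true)
... | yes found = inj₁ found
... | no none   = inj₂ (λ x → Bool.¬-not (λ fx → none (x , fx)))

finCounting : ∀ n → Counting (Fin n)
finCounting n = record
  { _≟_ = Fin._≟_ ; count = countFin ; count-false = countFin-false
  ; count-remove = λ {f} → countFin-remove {f = f} ; search = searchFin }

sumFin : ∀ {n} → (Fin n → ℕ) → ℕ
sumFin {zero}  g = 0
sumFin {suc n} g = g zero + sumFin (g ∘ suc)

sumFin-cong : ∀ {n} {g h : Fin n → ℕ} → (∀ x → g x ≡ h x) → sumFin g ≡ sumFin h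
sumFin-cong {zero}  eq = refl
sumFin-cong {suc n} eq = cong₂ _+_ (eq zero) (sumFin-cong (eq ∘ suc))

sumFin-suc-at : ∀ {n} {g h : Fin n → ℕ} a → g a ≡ suc (h a) → (∀ x → x ≢ a → g x ≡ h x) →
                sumFin g ≡ suc (sumFin h)
sumFin-suc-at zero    eqₐ eq = cong₂ _+_ eqₐ (sumFin-cong (λ x → eq (suc x) λ ()))
sumFin-suc-at (suc a) eqₐ eq =
  trans (cong₂ _+_ (eq zero λ ()) (sumFin-suc-at a eqₐ (λ x x≢a → eq (suc x) (x≢a ∘ Fin.suc-injective))))
        (+-suc _ _)

sumFin-if : ∀ {n} (f : Fin n → Bool) c → sumFin (λ x → if f x then c else 0) ≡ countFin f * c
sumFin-if {zero}  f c = refl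
sumFin-if {suc n} f c with f zero
... | true  = cong (c +_) (sumFin-if (f ∘ suc) c)
... | false = sumFin-if (f ∘ suc) c

module _ {n : ℕ} where

  _≟₂_ : DecidableEquality (Fin n × Fin n)
  _≟₂_ = Product.≡-dec Fin._≟_ Fin._≟_

  countPairs : (Fin n × Fin n → Bool) → ℕ
  countPairs f = sumFin (λ x → countFin (λ y → f (x , y)))

  countPairs-false : ∀ {f : Fin n × Fin n → Bool} → (∀ p → f p ≡ false) → countPairs f ≡ 0
  countPairs-false none = trans (sumFin-cong (λ x → countFin-false (λ y → none (x , y)))) (sumFin-zero n)
    where
    sumFin-zero : ∀ m → sumFin {m} (λ _ → 0) ≡ 0
    sumFin-zero zero    = refl
    sumFin-zero (suc m) = sumFin-zero m

  countPairs-remove : ∀ {f : Fin n × Fin n → Bool} {p} → f p ≡ true →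
                      countPairs f ≡ suc (countPairs (remove _≟₂_ f p))
  countPairs-remove {f} {a , b} fab =
    sumFin-suc-at a (trans (countFin-remove {f = λ y → f (a , y)} fab) (cong suc (countFin-cong row-a)))
                  other-rows
    where
    row-a : ∀ y → remove Fin._≟_ (λ y → f (a , y)) b y ≡ remove _≟₂_ f (a , b) (a , y)
    row-a y with y Fin.≟ b
    ... | yes refl = sym (remove-self _≟₂_ f (a , y))
    ... | no y≢b   = sym (remove-other _≟₂_ f {a , b} {a , y} (y≢b ∘ cong proj₂))
    other-rows : ∀ x → x ≢ a → countFin (λ y → f (x , y)) ≡ countFin (λ y → remove _≟₂_ f (a , b) (x , y))
    other-rows x x≢a = countFin-cong (λ y → sym (remove-other _≟₂_ f {a , b} {x , y} (x≢a ∘ cong proj₁)))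

  searchPairs : ∀ (f : Fin n × Fin n → Bool) → (∃ λ p → f p ≡ true) ⊎ (∀ p → f p ≡ false)
  searchPairs f with Fin.any? (λ x → Fin.any? (λ y → f (x , y) Bool.≟ true))
  ... | yes (x , y , fxy) = inj₁ ((x , y) , fxy)
  ... | no none           = inj₂ (λ (x , y) → Bool.¬-not (λ fxy → none (x , y , fxy)))

pairCounting : ∀ n → Counting (Fin n × Fin n)
pairCounting n = record
  { _≟_ = _≟₂_ ; count = countPairs ; count-false = countPairs-false
  ; count-remove = λ {f} → countPairs-remove {f = f} ; search = searchPairs }

countPairs-distinct : ∀ {n} (f : Fin n → Bool) →
  countPairs (λ (x , y) → f x ∧ remove Fin._≟_ f x y) ≡ countFin f * (countFin f ∸ 1)
countPairs-distinct f = trans (sumFin-cong row) (sumFin-if f _)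
  where
  row : ∀ x → countFin (λ y → f x ∧ remove Fin._≟_ f x y) ≡ (if f x then countFin f ∸ 1 else 0)
  row x with f x in fx
  ... | true  = cong (_∸ 1) (sym (countFin-remove {f = f} fx))
  ... | false = countFin-false {f = λ y → false ∧ remove Fin._≟_ f x y} (λ _ → refl)

-- Subsets of Fin n

∣p∣≡countFin : ∀ {n} (p : Subset n) → ∣ p ∣ ≡ countFin (lookup p)
∣p∣≡countFin []          = refl
∣p∣≡countFin (true ∷ p)  = cong suc (∣p∣≡countFin p)
∣p∣≡countFin (false ∷ p) = ∣p∣≡countFin p

∣p∪q∣≡∣p∣+∣q∣ : ∀ {n} (p q : Subset n) → p ∩ q ≡ ⊥ → ∣ p ∪ q ∣ ≡ ∣ p ∣ + ∣ q ∣
∣p∪q∣≡∣p∣+∣q∣ []          []          _  = refl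
∣p∪q∣≡∣p∣+∣q∣ (true ∷ p)  (false ∷ q) eq = cong suc (∣p∪q∣≡∣p∣+∣q∣ p q (Vec.∷-injectiveʳ eq))
∣p∪q∣≡∣p∣+∣q∣ (false ∷ p) (true ∷ q)  eq =
  trans (cong suc (∣p∪q∣≡∣p∣+∣q∣ p q (Vec.∷-injectiveʳ eq))) (sym (+-suc ∣ p ∣ ∣ q ∣))
∣p∪q∣≡∣p∣+∣q∣ (false ∷ p) (false ∷ q) eq = ∣p∪q∣≡∣p∣+∣q∣ p q (Vec.∷-injectiveʳ eq)

disjoint : ∀ {n} {p q : Subset n} {x} → p ∩ q ≡ ⊥ → x ∈ p → x ∉ q
disjoint {p = p} {q} p∩q≡⊥ x∈p x∈q = ∉⊥ (subst (_ ∈_) p∩q≡⊥ (x∈p∩q⁺ (x∈p , x∈q)))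

⊆-or-witness : ∀ {n} (t U : Subset n) → t ⊆ U ⊎ ∃ λ x → x ∈ t × x ∉ U
⊆-or-witness t U with Fin.any? (λ x → x ∈? t ×-dec ¬? (x ∈? U))
... | yes (x , x∈t , x∉U) = inj₂ (x , x∈t , x∉U)
... | no none = inj₁ λ {x} x∈t → decidable-stable (x ∈? U) (λ x∉U → none (x , x∈t , x∉U))

disjoint-∪ : ∀ {n} {p q r : Subset n} → p ∩ q ≡ ⊥ → p ∩ r ≡ ⊥ → p ∩ (q ∪ r) ≡ ⊥
disjoint-∪ {p = p} {q} {r} p∩q≡⊥ p∩r≡⊥ =
  trans (∩-distribˡ-∪ p q r) (trans (cong₂ _∪_ p∩q≡⊥ p∩r≡⊥) (∪-idem ⊥))

module _ {n : ℕ} where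
  open CountingProperties (finCounting n)

  IsTriple : Subset n → Fin n → Fin n → Fin n → Set
  IsTriple t a b c = a ∈ t × b ∈ t × c ∈ t × a ≢ b × c ≢ a × c ≢ b ×
                     (∀ {u} → u ∈ t → u ≡ a ⊎ u ≡ b ⊎ u ≡ c)

  ∣t∣≡1⇒unique : ∀ {t : Subset n} {x y} → ∣ t ∣ ≡ 1 → x ∈ t → y ∈ t → x ≡ y
  ∣t∣≡1⇒unique {t} {x} {y} ∣t∣≡1 x∈t y∈t with x Fin.≟ y
  ... | yes x≡y = x≡y
  ... | no x≢y with () ← trans (sym ∣t∣≡1)
          (trans (∣p∣≡countFin t) (count-remove₂ ([]=⇒lookup x∈t) ([]=⇒lookup y∈t) (x≢y ∘ sym)))

  ∣t∣≡3⇒third : ∀ {t : Subset n} {x y} → ∣ t ∣ ≡ 3 → x ∈ t → y ∈ t → x ≢ y → ∃ (IsTriple t x y)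
  ∣t∣≡3⇒third {t} ∣t∣≡3 x∈t y∈t x≢y
    with z , tz , z≢x , z≢y , members ←
           count≡3⇒third (trans (sym (∣p∣≡countFin t)) ∣t∣≡3) ([]=⇒lookup x∈t) ([]=⇒lookup y∈t) x≢y
    = z , x∈t , y∈t , lookup⇒[]= z t tz , x≢y , z≢x , z≢y , λ {u} u∈t → members u ([]=⇒lookup u∈t)

  ∣t∣≡3⇒IsTriple : ∀ {t : Subset n} {a b c} → ∣ t ∣ ≡ 3 → a ∈ t → b ∈ t → c ∈ t →
                   a ≢ b → c ≢ a → c ≢ b → IsTriple t a b c
  ∣t∣≡3⇒IsTriple ∣t∣≡3 a∈t b∈t c∈t a≢b c≢a c≢b
    with z , _ , _ , _ , _ , _ , _ , members ← ∣t∣≡3⇒third ∣t∣≡3 a∈t b∈t a≢b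
    with members c∈t
  ... | inj₁ c≡a        = ⊥-elim (c≢a c≡a)
  ... | inj₂ (inj₁ c≡b) = ⊥-elim (c≢b c≡b)
  ... | inj₂ (inj₂ refl) = a∈t , b∈t , c∈t , a≢b , c≢a , c≢b , members

  IsTriple-swap : ∀ {t : Subset n} {a b c} → IsTriple t a b c → IsTriple t b a c
  IsTriple-swap (a∈t , b∈t , c∈t , a≢b , c≢a , c≢b , members) =
    b∈t , a∈t , c∈t , a≢b ∘ sym , c≢b , c≢a , λ u∈t → [ inj₂ ∘ inj₁ , [ inj₁ , inj₂ ∘ inj₂ ]′ ]′ (members u∈t)

  IsTriple-unique : ∀ {t u : Subset n} {a b c} → IsTriple t a b c → IsTriple u a b c → t ≡ u
  IsTriple-unique t-abc u-abc = ⊆-antisym (⊆-triple t-abc u-abc) (⊆-triple u-abc t-abc)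
    where
    ⊆-triple : ∀ {t u a b c} → IsTriple t a b c → IsTriple u a b c → t ⊆ u
    ⊆-triple (_ , _ , _ , _ , _ , _ , members) (a∈u , b∈u , c∈u , _) x∈t with members x∈t
    ... | inj₁ refl        = a∈u
    ... | inj₂ (inj₁ refl) = b∈u
    ... | inj₂ (inj₂ refl) = c∈u

  ∣t∣≡3⇒enumeration : ∀ {t : Subset n} → ∣ t ∣ ≡ 3 → ∃ λ a → ∃ λ b → ∃ (IsTriple t a b)
  ∣t∣≡3⇒enumeration {t} ∣t∣≡3 = enumerate (trans (sym (∣p∣≡countFin t)) ∣t∣≡3)
    where
    enumerate : countFin (lookup t) ≡ 3 → ∃ λ a → ∃ λ b → ∃ (IsTriple t a b)
    enumerate count≡3
      with a , ta ← count≡suc⇒true count≡3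
      with b , t₋ₐb ← count≡suc⇒true (cong (_∸ 1) (trans (sym (countFin-remove {f = lookup t} ta)) count≡3))
      with tb , b≢a ← remove-true⁻ Fin._≟_ (lookup t) t₋ₐb
      = a , b , ∣t∣≡3⇒third ∣t∣≡3 (lookup⇒[]= a t ta) (lookup⇒[]= b t tb) (b≢a ∘ sym)

-- Steiner triple systems

module SteinerTripleSystem {n} {V : Subset n} {𝒞 : Coll n} (sts : IsSTS V 𝒞) where

  block-size : ∀ {t} → 𝒞 t → ∣ t ∣ ≡ 3
  block-size {t} 𝒞t = proj₁ (proj₁ sts t 𝒞t)

  block⊆V : ∀ {t} → 𝒞 t → t ⊆ V
  block⊆V {t} 𝒞t = proj₂ (proj₁ sts t 𝒞t)

  block-unique : ∀ {t t′ x y} → 𝒞 t → 𝒞 t′ → x ∈ t → y ∈ t → x ∈ t′ → y ∈ t′ → x ≢ y → t ≡ t′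
  block-unique {t} {t′} {x} {y} 𝒞t 𝒞t′ x∈t y∈t x∈t′ y∈t′ x≢y =
    proj₂ (proj₂ sts x y (block⊆V 𝒞t x∈t) (block⊆V 𝒞t y∈t) x≢y) t t′ 𝒞t 𝒞t′ x∈t y∈t x∈t′ y∈t′

  private
    third-witness : ∀ {x y} → x ∈ V → y ∈ V → x ≢ y → ∃ λ z → ∃ λ t → 𝒞 t × IsTriple t x y z
    third-witness {x} {y} x∈V y∈V x≢y
      with t , 𝒞t , x∈t , y∈t ← proj₁ (proj₂ sts x y x∈V y∈V x≢y)
      with z , xyz ← ∣t∣≡3⇒third (block-size 𝒞t) x∈t y∈t x≢y
      = z , t , 𝒞t , xyz

  -- Junk value x unless x and y are distinct points of V.
  third : Fin n → Fin n → Fin n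
  third x y with x ∈? V | y ∈? V | x Fin.≟ y
  ... | yes x∈V | yes y∈V | no x≢y = proj₁ (third-witness x∈V y∈V x≢y)
  ... | _       | _       | _      = x

  third-block : ∀ {x y} → x ∈ V → y ∈ V → x ≢ y → ∃ λ t → 𝒞 t × IsTriple t x y (third x y)
  third-block {x} {y} x∈V y∈V x≢y with x ∈? V | y ∈? V | x Fin.≟ y
  ... | yes x∈V′ | yes y∈V′ | no x≢y′ = proj₂ (third-witness x∈V′ y∈V′ x≢y′)
  ... | no x∉V   | _        | _       = ⊥-elim (x∉V x∈V)
  ... | yes _    | no y∉V   | _       = ⊥-elim (y∉V y∈V)
  ... | yes _    | yes _    | yes x≡y = ⊥-elim (x≢y x≡y)

  block-triple : ∀ {t x y} → 𝒞 t → x ∈ t → y ∈ t → x ≢ y → IsTriple t x y (third x y)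
  block-triple {t} 𝒞t x∈t y∈t x≢y
    with t′ , 𝒞t′ , xyz@(x∈t′ , y∈t′ , _) ← third-block (block⊆V 𝒞t x∈t) (block⊆V 𝒞t y∈t) x≢y
    rewrite block-unique 𝒞t 𝒞t′ x∈t y∈t x∈t′ y∈t′ x≢y = xyz

  third∈block : ∀ {t x y} → 𝒞 t → x ∈ t → y ∈ t → x ≢ y → third x y ∈ t
  third∈block 𝒞t x∈t y∈t x≢y with _ , _ , z∈t , _ ← block-triple 𝒞t x∈t y∈t x≢y = z∈t

  third-unique : ∀ {t x y z} → 𝒞 t → x ∈ t → y ∈ t → z ∈ t → x ≢ y → z ≢ x → z ≢ y → z ≡ third x y
  third-unique 𝒞t x∈t y∈t z∈t x≢y z≢x z≢y
    with _ , _ , _ , _ , _ , _ , members ← block-triple 𝒞t x∈t y∈t x≢y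
    with members z∈t
  ... | inj₁ z≡x        = ⊥-elim (z≢x z≡x)
  ... | inj₂ (inj₁ z≡y) = ⊥-elim (z≢y z≡y)
  ... | inj₂ (inj₂ z≡w) = z≡w

  module _ {x y} (x∈V : x ∈ V) (y∈V : y ∈ V) (x≢y : x ≢ y) where

    third∈V : third x y ∈ V
    third∈V with t , 𝒞t , _ , _ , z∈t , _ ← third-block x∈V y∈V x≢y = block⊆V 𝒞t z∈t

    third≢ˡ : third x y ≢ x
    third≢ˡ with _ , _ , _ , _ , _ , _ , z≢x , _ ← third-block x∈V y∈V x≢y = z≢x

    third≢ʳ : third x y ≢ y
    third≢ʳ with _ , _ , _ , _ , _ , _ , _ , z≢y , _ ← third-block x∈V y∈V x≢y = z≢y

    third-comm : third y x ≡ third x y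
    third-comm with t , 𝒞t , x∈t , y∈t , z∈t , _ , z≢x , z≢y , _ ← third-block x∈V y∈V x≢y
      = sym (third-unique 𝒞t y∈t x∈t z∈t (x≢y ∘ sym) z≢y z≢x)

    third-involutive : third x (third x y) ≡ y
    third-involutive with t , 𝒞t , x∈t , y∈t , z∈t , _ , z≢x , z≢y , _ ← third-block x∈V y∈V x≢y
      = sym (third-unique 𝒞t x∈t z∈t y∈t (z≢x ∘ sym) (x≢y ∘ sym) (z≢y ∘ sym))

  block⊆ : ∀ {U t x y} → 𝒞 t → x ∈ t → y ∈ t → x ≢ y → x ∈ U → y ∈ U → third x y ∈ U → t ⊆ U
  block⊆ 𝒞t x∈t y∈t x≢y x∈U y∈U z∈U u∈t
    with _ , _ , _ , _ , _ , _ , members ← block-triple 𝒞t x∈t y∈t x≢y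
    with members u∈t
  ... | inj₁ refl        = x∈U
  ... | inj₂ (inj₁ refl) = y∈U
  ... | inj₂ (inj₂ refl) = z∈U

  open CountingProperties using (FreeInvolution; FreeOrder3; free-involution⇒2∣count; free-order3⇒3∣count)

  order-odd : ∀ {p} → p ∈ V → 2 ∣ ∣ V ∣ ∸ 1
  order-odd {p} p∈V = subst (2 ∣_) (sym ∣V∣∸1≡) (free-involution⇒2∣count (finCounting n) involution)
    where
    others = remove Fin._≟_ (lookup V) p
    ∣V∣∸1≡ : ∣ V ∣ ∸ 1 ≡ countFin others
    ∣V∣∸1≡ = cong (_∸ 1) (trans (∣p∣≡countFin V) (countFin-remove {f = lookup V} ([]=⇒lookup p∈V)))
    other : ∀ {x} → others x ≡ true → x ∈ V × p ≢ x
    other {x} h with Vx , x≢p ← remove-true⁻ Fin._≟_ (lookup V) h = lookup⇒[]= x V Vx , x≢p ∘ sym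
    involution : FreeInvolution (finCounting n) (third p) others
    involution = record
      { closed     = λ h → let x∈V , p≢x = other h in
          remove-true⁺ Fin._≟_ (lookup V) ([]=⇒lookup (third∈V p∈V x∈V p≢x)) (third≢ˡ p∈V x∈V p≢x)
      ; involutive = λ h → let x∈V , p≢x = other h in third-involutive p∈V x∈V p≢x
      ; no-fixed   = λ h → let x∈V , p≢x = other h in third≢ʳ p∈V x∈V p≢x
      }

  3∣order*[order∸1] : 3 ∣ ∣ V ∣ * (∣ V ∣ ∸ 1)
  3∣order*[order∸1] = subst (3 ∣_) ∣V∣*[∣V∣∸1]≡ (free-order3⇒3∣count (pairCounting n) rotation)
    where
    distinct : Fin n × Fin n → Bool
    distinct (x , y) = lookup V x ∧ remove Fin._≟_ (lookup V) x y
    ∣V∣*[∣V∣∸1]≡ : countPairs distinct ≡ ∣ V ∣ * (∣ V ∣ ∸ 1)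
    ∣V∣*[∣V∣∸1]≡ rewrite ∣p∣≡countFin V = countPairs-distinct (lookup V)
    distinct⁻ : ∀ {x y} → distinct (x , y) ≡ true → x ∈ V × y ∈ V × x ≢ y
    distinct⁻ {x} {y} h with Vy , y≢x ← remove-true⁻ Fin._≟_ (lookup V) (Bool.∧-conicalʳ (lookup V x) _ h) =
      lookup⇒[]= x V (Bool.∧-conicalˡ _ _ h) , lookup⇒[]= y V Vy , y≢x ∘ sym
    distinct⁺ : ∀ {x y} → x ∈ V → y ∈ V → x ≢ y → distinct (x , y) ≡ true
    distinct⁺ x∈V y∈V x≢y =
      cong₂ _∧_ ([]=⇒lookup x∈V) (remove-true⁺ Fin._≟_ (lookup V) ([]=⇒lookup y∈V) (x≢y ∘ sym))
    σ : Fin n × Fin n → Fin n × Fin n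
    σ (x , y) = y , third x y
    order3 : ∀ {x y} → x ∈ V → y ∈ V → x ≢ y → σ (σ (σ (x , y))) ≡ (x , y)
    order3 {x} {y} x∈V y∈V x≢y = cong₂ _,_ third-yz≡x (trans (cong (third z) third-yz≡x) third-zx≡y)
      where
      z = third x y
      third-yz≡x : third y z ≡ x
      third-yz≡x = trans (cong (third y) (sym (third-comm x∈V y∈V x≢y))) (third-involutive y∈V x∈V (x≢y ∘ sym))
      third-zx≡y : third z x ≡ y
      third-zx≡y = trans (third-comm x∈V (third∈V x∈V y∈V x≢y) (third≢ˡ x∈V y∈V x≢y ∘ sym))
                         (third-involutive x∈V y∈V x≢y)
    rotation : FreeOrder3 (pairCounting n) σ distinct
    rotation = record
      { closed   = λ h → let x∈V , y∈V , x≢y = distinct⁻ h in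
          distinct⁺ y∈V (third∈V x∈V y∈V x≢y) (third≢ʳ x∈V y∈V x≢y ∘ sym)
      ; order3   = λ h → let x∈V , y∈V , x≢y = distinct⁻ h in order3 x∈V y∈V x≢y
      ; no-fixed = λ h σp≡p → proj₂ (proj₂ (distinct⁻ h)) (sym (cong proj₁ σp≡p))
      }

  order-mod6 : ∀ {p} → p ∈ V → ∣ V ∣ % 6 ≡ 1 ⊎ ∣ V ∣ % 6 ≡ 3
  order-mod6 {p} p∈V with ∣ V ∣ in ∣V∣≡
  ... | zero with () ← trans (sym ∣V∣≡) (trans (∣p∣≡countFin V) (countFin-remove {f = lookup V} ([]=⇒lookup p∈V)))
  ... | suc u = suc-even-mod6 u (subst (λ v → 2 ∣ v ∸ 1) ∣V∣≡ (order-odd p∈V))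
                              (subst (λ v → 3 ∣ v * (v ∸ 1)) ∣V∣≡ 3∣order*[order∸1])

  Restriction : Subset n → Coll n
  Restriction U t = 𝒞 t × t ⊆ U

  RestrictionWithout : Subset n → Subset n → Coll n
  RestrictionWithout U T t = Restriction U t × t ≢ T

  block-within : ∀ {U x y} → U ⊆ V → x ∈ U → y ∈ U → x ≢ y → third x y ∈ U →
                 ∃ λ t → Restriction U t × x ∈ t × y ∈ t
  block-within U⊆V x∈U y∈U x≢y z∈U
    with t , 𝒞t , x∈t , y∈t , _ ← third-block (U⊆V x∈U) (U⊆V y∈U) x≢y
    = t , (𝒞t , block⊆ 𝒞t x∈t y∈t x≢y x∈U y∈U z∈U) , x∈t , y∈t

  closed⇒SubSTS : ∀ {U} (𝒟 : Coll n) → U ⊆ V →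
    (∀ {x y} → x ∈ U → y ∈ U → x ≢ y → third x y ∈ U) →
    𝒟 ⊑ Restriction U → Restriction U ⊑ 𝒟 → SubSTS 𝒞 U 𝒟
  closed⇒SubSTS {U} 𝒟 U⊆V closed 𝒟⊑ ⊑𝒟 =
    (λ t 𝒟t → proj₁ (𝒟⊑ t 𝒟t)) ,
    (λ t 𝒟t → let 𝒞t , t⊆U = 𝒟⊑ t 𝒟t in block-size 𝒞t , t⊆U) ,
    λ x y x∈U y∈U x≢y →
      (let t , Rt , x∈t , y∈t = block-within U⊆V x∈U y∈U x≢y (closed x∈U y∈U x≢y) in t , ⊑𝒟 t Rt , x∈t , y∈t) ,
      λ t t′ 𝒟t 𝒟t′ x∈t y∈t x∈t′ y∈t′ →
        block-unique (proj₁ (𝒟⊑ t 𝒟t)) (proj₁ (𝒟⊑ t′ 𝒟t′)) x∈t y∈t x∈t′ y∈t′ x≢y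

  almost-closed⇒AlmostSubSTS : ∀ {U T} (𝒟 : Coll n) → U ⊆ V → T ⊆ U → ∣ T ∣ ≡ 3 →
    (∀ {x y} → x ∈ U → y ∈ U → x ≢ y → x ∉ T ⊎ y ∉ T → third x y ∈ U) →
    (∀ {x y} → x ∈ T → y ∈ T → x ≢ y → third x y ∈ U → third x y ∈ T) →
    𝒟 ⊑ RestrictionWithout U T → RestrictionWithout U T ⊑ 𝒟 → AlmostSubSTS 𝒞 U T 𝒟
  almost-closed⇒AlmostSubSTS {U} {T} 𝒟 U⊆V T⊆U ∣T∣≡3 closed-off-T third-of-T-pair 𝒟⇒ ⇒𝒟 =
    (λ t 𝒟t → proj₁ (proj₁ (𝒟⇒ t 𝒟t))) , 𝒞′ , (sizes , pairs) , inj₂ refl ,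
    λ t → (λ 𝒟t → let Rt , t≢T = 𝒟⇒ t 𝒟t in inj₁ Rt , t≢T) ,
          λ { (inj₁ Rt , t≢T) → ⇒𝒟 t (Rt , t≢T) ; (inj₂ t≡T , t≢T) → ⊥-elim (t≢T t≡T) }
    where
    𝒞′ : Coll n
    𝒞′ t = Restriction U t ⊎ t ≡ T

    sizes : ∀ t → 𝒞′ t → ∣ t ∣ ≡ 3 × t ⊆ U
    sizes t (inj₁ (𝒞t , t⊆U)) = block-size 𝒞t , t⊆U
    sizes t (inj₂ refl)       = ∣T∣≡3 , T⊆U

    block-through-T-pair : ∀ {t x y} → Restriction U t → x ∈ t → y ∈ t → x ∈ T → y ∈ T → x ≢ y → t ≡ T
    block-through-T-pair (𝒞t , t⊆U) x∈t y∈t x∈T y∈T x≢y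
      with xyz@(_ , _ , z∈t , _ , z≢x , z≢y , _) ← block-triple 𝒞t x∈t y∈t x≢y
      = IsTriple-unique xyz (∣t∣≡3⇒IsTriple ∣T∣≡3 x∈T y∈T (third-of-T-pair x∈T y∈T x≢y (t⊆U z∈t)) x≢y z≢x z≢y)

    pairs : ∀ x y → x ∈ U → y ∈ U → x ≢ y → ExactlyOne 𝒞′ x y
    pairs x y x∈U y∈U x≢y = exists (x ∈? T) (y ∈? T) , unique
      where
      restricted : x ∉ T ⊎ y ∉ T → ∃ λ t → 𝒞′ t × x ∈ t × y ∈ t
      restricted off with t , Rt , x∈t , y∈t ← block-within U⊆V x∈U y∈U x≢y (closed-off-T x∈U y∈U x≢y off)
        = t , inj₁ Rt , x∈t , y∈t
      exists : Dec (x ∈ T) → Dec (y ∈ T) → ∃ λ t → 𝒞′ t × x ∈ t × y ∈ t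
      exists (yes x∈T) (yes y∈T) = T , inj₂ refl , x∈T , y∈T
      exists (no x∉T)  _         = restricted (inj₁ x∉T)
      exists (yes _)   (no y∉T)  = restricted (inj₂ y∉T)
      unique : ∀ t t′ → 𝒞′ t → 𝒞′ t′ → x ∈ t → y ∈ t → x ∈ t′ → y ∈ t′ → t ≡ t′
      unique t t′ (inj₁ (𝒞t , _)) (inj₁ (𝒞t′ , _)) x∈t y∈t x∈t′ y∈t′ = block-unique 𝒞t 𝒞t′ x∈t y∈t x∈t′ y∈t′ x≢y
      unique t t′ (inj₁ Rt) (inj₂ refl) x∈t y∈t x∈T y∈T = block-through-T-pair Rt x∈t y∈t x∈T y∈T x≢y
      unique t t′ (inj₂ refl) (inj₁ Rt′) x∈T y∈T x∈t′ y∈t′ = sym (block-through-T-pair Rt′ x∈t′ y∈t′ x∈T y∈T x≢y)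
      unique t t′ (inj₂ refl) (inj₂ refl) _ _ _ _ = refl

≢0∧≢1⇒≡2 : ∀ {k : Fin 3} → k ≢ zero → k ≢ suc zero → k ≡ suc (suc zero)
≢0∧≢1⇒≡2 {zero}           k≢0 _   = ⊥-elim (k≢0 refl)
≢0∧≢1⇒≡2 {suc zero}       _   k≢1 = ⊥-elim (k≢1 refl)
≢0∧≢1⇒≡2 {suc (suc zero)} _   _   = refl

module Configuration (w n : ℕ) (A B C D : Subset n)
  (A∩B≡⊥ : A ∩ B ≡ ⊥) (A∩C≡⊥ : A ∩ C ≡ ⊥) (A∩D≡⊥ : A ∩ D ≡ ⊥)
  (B∩C≡⊥ : B ∩ C ≡ ⊥) (B∩D≡⊥ : B ∩ D ≡ ⊥) (C∩D≡⊥ : C ∩ D ≡ ⊥)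
  (∣A∣≡w : ∣ A ∣ ≡ w) (∣B∣≡w : ∣ B ∣ ≡ w) (∣C∣≡w : ∣ C ∣ ≡ w) (∣D∣≡3 : ∣ D ∣ ≡ 3)
  (𝓑 𝒯 : Coll n) (sts : IsSTS (A ∪ B ∪ C ∪ D) 𝓑) (𝒯⊑𝓑 : 𝒯 ⊑ 𝓑) (td : IsTD3 w (groups A B C) 𝒯)
  where

  open SteinerTripleSystem sts
  open CountingProperties (finCounting n) using (free-involution⇒2∣count)

  S : Subset n
  S = A ∪ B ∪ C ∪ D

  G : Fin 3 → Subset n
  G = groups A B C

  G⁺ : Fin 3 → Subset n
  G⁺ i = G i ∪ D

  ∣G∣≡w : ∀ i → ∣ G i ∣ ≡ w
  ∣G∣≡w = proj₁ td

  G∩D≡⊥ : ∀ i → G i ∩ D ≡ ⊥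
  G∩D≡⊥ zero             = A∩D≡⊥
  G∩D≡⊥ (suc zero)       = B∩D≡⊥
  G∩D≡⊥ (suc (suc zero)) = C∩D≡⊥

  G-disjoint : ∀ {i j x} → x ∈ G i → x ∈ G j → i ≡ j
  G-disjoint {i} {j} x∈Gi x∈Gj with i Fin.≟ j
  ... | yes i≡j = i≡j
  ... | no i≢j  = ⊥-elim (disjoint (proj₁ (proj₂ td) i j i≢j) x∈Gi x∈Gj)

  G∉D : ∀ {i x} → x ∈ G i → x ∉ D
  G∉D {i} = disjoint (G∩D≡⊥ i)

  G⊆S : ∀ i → G i ⊆ S
  G⊆S zero             x∈A = x∈p∪q⁺ (inj₁ x∈A)
  G⊆S (suc zero)       x∈B = x∈p∪q⁺ (inj₂ (x∈p∪q⁺ (inj₁ x∈B)))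
  G⊆S (suc (suc zero)) x∈C = x∈p∪q⁺ (inj₂ (x∈p∪q⁺ (inj₂ (x∈p∪q⁺ (inj₁ x∈C)))))

  D⊆S : D ⊆ S
  D⊆S x∈D = x∈p∪q⁺ (inj₂ (x∈p∪q⁺ (inj₂ (x∈p∪q⁺ (inj₂ x∈D)))))

  D⊆G⁺ : ∀ i → D ⊆ G⁺ i
  D⊆G⁺ i x∈D = x∈p∪q⁺ (inj₂ x∈D)

  G⁺⊆S : ∀ i → G⁺ i ⊆ S
  G⁺⊆S i x∈G⁺ with x∈p∪q⁻ (G i) D x∈G⁺
  ... | inj₁ x∈G = G⊆S i x∈G
  ... | inj₂ x∈D = D⊆S x∈D

  G⁺∖D⊆G : ∀ {i x} → x ∈ G⁺ i → x ∉ D → x ∈ G i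
  G⁺∖D⊆G {i} x∈G⁺ x∉D with x∈p∪q⁻ (G i) D x∈G⁺
  ... | inj₁ x∈G = x∈G
  ... | inj₂ x∈D = ⊥-elim (x∉D x∈D)

  S-cases : ∀ {x} → x ∈ S → (∃ λ i → x ∈ G i) ⊎ x ∈ D
  S-cases x∈S with x∈p∪q⁻ A _ x∈S
  ... | inj₁ x∈A = inj₁ (zero , x∈A)
  ... | inj₂ x∈BCD with x∈p∪q⁻ B _ x∈BCD
  ...   | inj₁ x∈B = inj₁ (suc zero , x∈B)
  ...   | inj₂ x∈CD with x∈p∪q⁻ C D x∈CD
  ...     | inj₁ x∈C = inj₁ (suc (suc zero) , x∈C)
  ...     | inj₂ x∈D = inj₂ x∈D

  ABC-cases : ∀ {x} → x ∈ A ∪ B ∪ C → ∃ λ i → x ∈ G i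
  ABC-cases x∈ABC with x∈p∪q⁻ A _ x∈ABC
  ... | inj₁ x∈A = zero , x∈A
  ... | inj₂ x∈BC with x∈p∪q⁻ B C x∈BC
  ...   | inj₁ x∈B = suc zero , x∈B
  ...   | inj₂ x∈C = suc (suc zero) , x∈C

  outside-G⁺ : ∀ {i x} → x ∈ S → x ∉ G⁺ i → ∃ λ j → x ∈ G j × j ≢ i
  outside-G⁺ {i} x∈S x∉G⁺ with S-cases x∈S
  ... | inj₂ x∈D        = ⊥-elim (x∉G⁺ (D⊆G⁺ i x∈D))
  ... | inj₁ (j , x∈Gj) = j , x∈Gj , λ { refl → x∉G⁺ (x∈p∪q⁺ (inj₁ x∈Gj)) }

  ∣S∣≡ : ∣ S ∣ ≡ w + (w + (w + 3))
  ∣S∣≡ = begin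
    ∣ A ∪ (B ∪ (C ∪ D)) ∣             ≡⟨ ∣p∪q∣≡∣p∣+∣q∣ A _ (disjoint-∪ A∩B≡⊥ (disjoint-∪ A∩C≡⊥ A∩D≡⊥)) ⟩
    ∣ A ∣ + ∣ B ∪ (C ∪ D) ∣           ≡⟨ cong (∣ A ∣ +_) (∣p∪q∣≡∣p∣+∣q∣ B _ (disjoint-∪ B∩C≡⊥ B∩D≡⊥)) ⟩
    ∣ A ∣ + (∣ B ∣ + ∣ C ∪ D ∣)       ≡⟨ cong (λ c → ∣ A ∣ + (∣ B ∣ + c)) (∣p∪q∣≡∣p∣+∣q∣ C D C∩D≡⊥) ⟩
    ∣ A ∣ + (∣ B ∣ + (∣ C ∣ + ∣ D ∣)) ≡⟨ cong₂ (λ a b → a + (b + _)) ∣A∣≡w ∣B∣≡w ⟩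
    w + (w + (∣ C ∣ + ∣ D ∣))         ≡⟨ cong₂ (λ c d → w + (w + (c + d))) ∣C∣≡w ∣D∣≡3 ⟩
    w + (w + (w + 3))                 ∎
    where open ≡-Reasoning

  ∣G⁺∣≡ : ∀ i → ∣ G⁺ i ∣ ≡ w + 3
  ∣G⁺∣≡ i = trans (∣p∪q∣≡∣p∣+∣q∣ (G i) D (G∩D≡⊥ i)) (cong₂ _+_ (∣G∣≡w i) ∣D∣≡3)

  point-of-D : ∃ λ d → d ∈ D
  point-of-D = let a , _ , _ , a∈D , _ = ∣t∣≡3⇒enumeration ∣D∣≡3 in a , a∈D

  w-even : 2 ∣ w
  w-even = ∣m+n∣m⇒∣n 2∣2[w+1]+w (n∣m*n (w + 1))
    where
    2∣2[w+1]+w : 2 ∣ (w + 1) * 2 + w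
    2∣2[w+1]+w = subst (2 ∣_) (cong (_∸ 1) (trans ∣S∣≡ (3w+3≡ w))) (order-odd (D⊆S (proj₂ point-of-D)))

  td-block : ∀ {i j x y} → i ≢ j → x ∈ G i → y ∈ G j → ∃ λ t → 𝒯 t × x ∈ t × y ∈ t
  td-block {i} {j} {x} {y} i≢j x∈Gi y∈Gj = proj₁ (proj₂ (proj₂ (proj₂ td)) i j i≢j x y x∈Gi y∈Gj)

  td-block-meets-group-once : ∀ {t i x y} → 𝒯 t → x ∈ t → y ∈ t → x ∈ G i → y ∈ G i → x ≡ y
  td-block-meets-group-once {t} {i} 𝒯t x∈t y∈t x∈Gi y∈Gi =
    ∣t∣≡1⇒unique (∣t∩G∣≡1 i) (x∈p∩q⁺ (x∈t , x∈Gi)) (x∈p∩q⁺ (y∈t , y∈Gi))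
    where
    ∣t∩G∣≡1 : ∀ i → ∣ t ∩ G i ∣ ≡ 1
    ∣t∩G∣≡1 = proj₂ (proj₂ (proj₁ (proj₂ (proj₂ td)) t 𝒯t))

  td-block-avoids-D : ∀ {t x} → 𝒯 t → x ∈ t → x ∉ D
  td-block-avoids-D {t} 𝒯t x∈t = G∉D (proj₂ (ABC-cases (t⊆ABC x∈t)))
    where
    t⊆ABC : t ⊆ A ∪ B ∪ C
    t⊆ABC = proj₁ (proj₂ (proj₁ (proj₂ (proj₂ td)) t 𝒯t))

  block-across-groups⇒td : ∀ {t i j x y} → 𝓑 t → x ∈ t → y ∈ t → x ∈ G i → y ∈ G j → i ≢ j → 𝒯 t
  block-across-groups⇒td {x = x} {y} 𝓑t x∈t y∈t x∈Gi y∈Gj i≢j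
    with t′ , 𝒯t′ , x∈t′ , y∈t′ ← td-block i≢j x∈Gi y∈Gj
    = subst 𝒯 (block-unique (𝒯⊑𝓑 t′ 𝒯t′) 𝓑t x∈t′ y∈t′ x∈t y∈t x≢y) 𝒯t′
    where
    x≢y : x ≢ y
    x≢y refl = i≢j (G-disjoint x∈Gi y∈Gj)

  third-in-G⁺ : ∀ {i x y} → x ∈ G i → y ∈ G⁺ i → x ≢ y → third x y ∈ G⁺ i
  third-in-G⁺ {i} {x} {y} x∈Gi y∈G⁺ x≢y with third x y ∈? G⁺ i
  ... | yes z∈G⁺ = z∈G⁺
  ... | no z∉G⁺
    with j , z∈Gj , j≢i ← outside-G⁺ (third∈V (G⊆S i x∈Gi) (G⁺⊆S i y∈G⁺) x≢y) z∉G⁺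
    with t , 𝓑t , x∈t , y∈t , z∈t , _ ← third-block (G⊆S i x∈Gi) (G⁺⊆S i y∈G⁺) x≢y
    with 𝒯t ← block-across-groups⇒td 𝓑t x∈t z∈t x∈Gi z∈Gj (j≢i ∘ sym)
    with x∈p∪q⁻ (G i) D y∈G⁺
  ... | inj₁ y∈Gi = ⊥-elim (x≢y (td-block-meets-group-once 𝒯t x∈t y∈t x∈Gi y∈Gi))
  ... | inj₂ y∈D  = ⊥-elim (td-block-avoids-D 𝒯t y∈t y∈D)

  G⁺-closed-off-D : ∀ {i x y} → x ∈ G⁺ i → y ∈ G⁺ i → x ≢ y → x ∉ D ⊎ y ∉ D → third x y ∈ G⁺ i
  G⁺-closed-off-D x∈G⁺ y∈G⁺ x≢y (inj₁ x∉D) = third-in-G⁺ (G⁺∖D⊆G x∈G⁺ x∉D) y∈G⁺ x≢y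
  G⁺-closed-off-D {i} x∈G⁺ y∈G⁺ x≢y (inj₂ y∉D) =
    subst (_∈ G⁺ i) (third-comm (G⁺⊆S i x∈G⁺) (G⁺⊆S i y∈G⁺) x≢y)
          (third-in-G⁺ (G⁺∖D⊆G y∈G⁺ y∉D) x∈G⁺ (x≢y ∘ sym))

  block-split : ∀ {t} → 𝓑 t → 𝒯 t ⊎ ∃ λ j → t ⊆ G⁺ j
  block-split {t} 𝓑t
    with ⊆-or-witness t (G⁺ zero) | ⊆-or-witness t (G⁺ (suc zero)) | ⊆-or-witness t (G⁺ (suc (suc zero)))
  ... | inj₁ t⊆ | _ | _ = inj₂ (zero , t⊆)
  ... | inj₂ _ | inj₁ t⊆ | _ = inj₂ (suc zero , t⊆)
  ... | inj₂ _ | inj₂ _ | inj₁ t⊆ = inj₂ (suc (suc zero) , t⊆)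
  ... | inj₂ (u₀ , u₀∈t , u₀∉) | inj₂ (u₁ , u₁∈t , u₁∉) | inj₂ (u₂ , u₂∈t , u₂∉)
    with k₀ , u₀∈G , k₀≢0 ← outside-G⁺ (block⊆V 𝓑t u₀∈t) u₀∉
    with k₁ , u₁∈G , k₁≢1 ← outside-G⁺ (block⊆V 𝓑t u₁∈t) u₁∉
    with k₂ , u₂∈G , k₂≢2 ← outside-G⁺ (block⊆V 𝓑t u₂∈t) u₂∉
    with k₀ Fin.≟ k₁
  ... | no k₀≢k₁   = inj₁ (block-across-groups⇒td 𝓑t u₀∈t u₁∈t u₀∈G u₁∈G k₀≢k₁)
  ... | yes k₀≡k₁ = inj₁ (block-across-groups⇒td 𝓑t u₀∈t u₂∈t u₀∈G u₂∈G k₀≢k₂)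
    where
    k₀≢k₂ : k₀ ≢ k₂
    k₀≢k₂ k₀≡k₂ = k₂≢2 (trans (sym k₀≡k₂) (≢0∧≢1⇒≡2 k₀≢0 (k₁≢1 ∘ trans (sym k₀≡k₁))))

  -- Otherwise a ↦ third p a would be a fixed-point-free involution of G i ∖ {third p q},
  -- whose size w ∸ 1 is odd.
  third-D-pair-in-G : ∀ {i p q r} → IsTriple D p q r → third p q ∈ G i → third p r ∈ G i
  third-D-pair-in-G {i} {p} {q} {r} (p∈D , q∈D , _ , p≢q , _ , _ , D⊆pqr) e∈G with third p r ∈? G i
  ... | yes in-G   = in-G
  ... | no third∉G = ⊥-elim (2∤suc-of-even 2∣others (subst (2 ∣_) w≡ w-even))
    where
    e = third p q
    others = remove Fin._≟_ (lookup (G i)) e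
    w≡ : w ≡ suc (countFin others)
    w≡ = trans (sym (∣G∣≡w i)) (trans (∣p∣≡countFin (G i)) (countFin-remove {f = lookup (G i)} ([]=⇒lookup e∈G)))
    p∈S = D⊆S p∈D
    p≢ : ∀ {a} → a ∈ G i → p ≢ a
    p≢ a∈G refl = G∉D a∈G p∈D
    recover : ∀ {a b} → a ∈ G i → third p a ≡ b → a ≡ third p b
    recover a∈G refl = sym (third-involutive p∈S (G⊆S i a∈G) (p≢ a∈G))
    maps-into-G : ∀ {a} → a ∈ G i → a ≢ e → third p a ∈ G i
    maps-into-G a∈G a≢e
      with x∈p∪q⁻ (G i) D (G⁺-closed-off-D (D⊆G⁺ i p∈D) (x∈p∪q⁺ (inj₁ a∈G)) (p≢ a∈G) (inj₂ (G∉D a∈G)))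
    ... | inj₁ in-G = in-G
    ... | inj₂ in-D with D⊆pqr in-D
    ...   | inj₁ ≡p        = ⊥-elim (third≢ˡ p∈S (G⊆S i a∈G) (p≢ a∈G) ≡p)
    ...   | inj₂ (inj₁ ≡q) = ⊥-elim (a≢e (recover a∈G ≡q))
    ...   | inj₂ (inj₂ ≡r) = ⊥-elim (third∉G (subst (_∈ G i) (recover a∈G ≡r) a∈G))
    avoids-e : ∀ {a} → a ∈ G i → third p a ≢ e
    avoids-e a∈G ≡e =
      G∉D a∈G (subst (_∈ D) (sym (trans (recover a∈G ≡e) (third-involutive p∈S (D⊆S q∈D) p≢q))) q∈D)
    other : ∀ {a} → others a ≡ true → a ∈ G i × a ≢ e
    other {a} h with Ga , a≢e ← remove-true⁻ Fin._≟_ (lookup (G i)) h = lookup⇒[]= a (G i) Ga , a≢e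
    2∣others : 2 ∣ countFin others
    2∣others = free-involution⇒2∣count record
      { closed     = λ h → let a∈G , a≢e = other h in
          remove-true⁺ Fin._≟_ (lookup (G i)) ([]=⇒lookup (maps-into-G a∈G a≢e)) (avoids-e a∈G)
      ; involutive = λ h → let a∈G , _ = other h in third-involutive p∈S (G⊆S i a∈G) (p≢ a∈G)
      ; no-fixed   = λ h → let a∈G , _ = other h in third≢ʳ p∈S (G⊆S i a∈G) (p≢ a∈G)
      }

  AbsorbsD : Fin 3 → Set
  AbsorbsD i = ∀ {p q} → p ∈ D → q ∈ D → p ≢ q → third p q ∈ G⁺ i

  D-block⇒AbsorbsD : 𝓑 D → ∀ i → AbsorbsD i
  D-block⇒AbsorbsD 𝓑D i p∈D q∈D p≢q = D⊆G⁺ i (third∈block 𝓑D p∈D q∈D p≢q)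

  third-in-G⇒AbsorbsD : ∀ {i a b c} → IsTriple D a b c → third a b ∈ G i → AbsorbsD i
  third-in-G⇒AbsorbsD {i} {a} {b} {c} abc@(a∈D , b∈D , c∈D , a≢b , c≢a , c≢b , D⊆abc) ab∈G = absorbs
    where
    swap : ∀ {x y} → y ∈ D → x ∈ D → y ≢ x → third x y ∈ G i → third y x ∈ G i
    swap y∈D x∈D y≢x = subst (_∈ G i) (third-comm (D⊆S y∈D) (D⊆S x∈D) y≢x)
    ac∈G = third-D-pair-in-G abc ab∈G
    ba∈G = swap b∈D a∈D (a≢b ∘ sym) ab∈G
    bc∈G = third-D-pair-in-G (IsTriple-swap abc) ba∈G
    in-G : ∀ {p q} → p ∈ D → q ∈ D → p ≢ q → third p q ∈ G i
    in-G p∈D q∈D p≢q with D⊆abc p∈D | D⊆abc q∈D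
    ... | inj₁ refl        | inj₂ (inj₁ refl) = ab∈G
    ... | inj₁ refl        | inj₂ (inj₂ refl) = ac∈G
    ... | inj₂ (inj₁ refl) | inj₁ refl        = ba∈G
    ... | inj₂ (inj₁ refl) | inj₂ (inj₂ refl) = bc∈G
    ... | inj₂ (inj₂ refl) | inj₁ refl        = swap c∈D a∈D c≢a ac∈G
    ... | inj₂ (inj₂ refl) | inj₂ (inj₁ refl) = swap c∈D b∈D c≢b bc∈G
    ... | inj₁ refl        | inj₁ refl        = ⊥-elim (p≢q refl)
    ... | inj₂ (inj₁ refl) | inj₂ (inj₁ refl) = ⊥-elim (p≢q refl)
    ... | inj₂ (inj₂ refl) | inj₂ (inj₂ refl) = ⊥-elim (p≢q refl)
    absorbs : AbsorbsD i
    absorbs p∈D q∈D p≢q = x∈p∪q⁺ (inj₁ (in-G p∈D q∈D p≢q))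

  some-G⁺-absorbs-D : ∃ AbsorbsD
  some-G⁺-absorbs-D = from-triple (proj₂ (proj₂ (proj₂ (∣t∣≡3⇒enumeration ∣D∣≡3))))
    where
    from-triple : ∀ {a b c} → IsTriple D a b c → ∃ AbsorbsD
    from-triple {a} {b} abc@(a∈D , b∈D , _ , a≢b , _) = [ in-G , in-D ]′ (S-cases (third∈V a∈S b∈S a≢b))
      where
      a∈S = D⊆S a∈D
      b∈S = D⊆S b∈D
      in-G : (∃ λ i → third a b ∈ G i) → ∃ AbsorbsD
      in-G (i , ab∈G) = i , third-in-G⇒AbsorbsD abc ab∈G
      in-D : third a b ∈ D → ∃ AbsorbsD
      in-D ab∈D = zero , D-block⇒AbsorbsD (subst 𝓑 (IsTriple-unique abz D-abz) 𝓑t) zero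
        where
        block = third-block a∈S b∈S a≢b
        𝓑t = proj₁ (proj₂ block)
        abz = proj₂ (proj₂ block)
        D-abz = ∣t∣≡3⇒IsTriple ∣D∣≡3 a∈D b∈D ab∈D a≢b (third≢ˡ a∈S b∈S a≢b) (third≢ʳ a∈S b∈S a≢b)

  G⁺-closed : ∀ {i} → AbsorbsD i → ∀ {x y} → x ∈ G⁺ i → y ∈ G⁺ i → x ≢ y → third x y ∈ G⁺ i
  G⁺-closed absorbs {x} {y} x∈G⁺ y∈G⁺ x≢y with x ∈? D | y ∈? D
  ... | yes x∈D | yes y∈D = absorbs x∈D y∈D x≢y
  ... | no x∉D  | _       = G⁺-closed-off-D x∈G⁺ y∈G⁺ x≢y (inj₁ x∉D)
  ... | yes _   | no y∉D  = G⁺-closed-off-D x∈G⁺ y∈G⁺ x≢y (inj₂ y∉D)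

  -- The block D, if present, goes to part i.
  Part : Fin 3 → Fin 3 → Coll n
  Part i j t = 𝓑 t × t ⊆ G⁺ j × (j ≢ i → t ≢ D)

  Part-SubSTS : ∀ {i} → AbsorbsD i → SubSTS 𝓑 (G⁺ i) (Part i i)
  Part-SubSTS {i} absorbs = closed⇒SubSTS (Part i i) (G⁺⊆S i) (G⁺-closed absorbs)
    (λ t (𝓑t , t⊆G⁺ , _) → 𝓑t , t⊆G⁺)
    (λ t (𝓑t , t⊆G⁺) → 𝓑t , t⊆G⁺ , λ i≢i → ⊥-elim (i≢i refl))

  Part-AlmostSubSTS : ∀ {i j} → AbsorbsD i → j ≢ i → AlmostSubSTS 𝓑 (G⁺ j) D (Part i j)
  Part-AlmostSubSTS {i} {j} absorbs j≢i =
    almost-closed⇒AlmostSubSTS (Part i j) (G⁺⊆S j) (D⊆G⁺ j) ∣D∣≡3 G⁺-closed-off-D third-of-D-pair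
      (λ t (𝓑t , t⊆G⁺ , t≢D) → (𝓑t , t⊆G⁺) , t≢D j≢i)
      (λ t ((𝓑t , t⊆G⁺) , t≢D) → 𝓑t , t⊆G⁺ , λ _ → t≢D)
    where
    third-of-D-pair : ∀ {x y} → x ∈ D → y ∈ D → x ≢ y → third x y ∈ G⁺ j → third x y ∈ D
    third-of-D-pair x∈D y∈D x≢y z∈G⁺j with x∈p∪q⁻ (G j) D z∈G⁺j | x∈p∪q⁻ (G i) D (absorbs x∈D y∈D x≢y)
    ... | inj₂ z∈D  | _         = z∈D
    ... | inj₁ _    | inj₂ z∈D  = z∈D
    ... | inj₁ z∈Gj | inj₁ z∈Gi = ⊥-elim (j≢i (G-disjoint z∈Gj z∈Gi))

  Part-union : ∀ i → IsUnion4 𝓑 𝒯 (Part i zero) (Part i (suc zero)) (Part i (suc (suc zero)))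
  Part-union i t = split , merge
    where
    Parts : Set
    Parts = Part i zero t ⊎ Part i (suc zero) t ⊎ Part i (suc (suc zero)) t
    part : ∀ j → Part i j t → Parts
    part zero             = inj₁
    part (suc zero)       = inj₂ ∘ inj₁
    part (suc (suc zero)) = inj₂ ∘ inj₂
    split : 𝓑 t → 𝒯 t ⊎ Parts
    split 𝓑t with block-split 𝓑t | Vec.≡-dec Bool._≟_ t D
    ... | inj₁ 𝒯t         | _        = inj₁ 𝒯t
    ... | inj₂ _          | yes refl = inj₂ (part i (𝓑t , D⊆G⁺ i , λ i≢i → ⊥-elim (i≢i refl)))
    ... | inj₂ (j , t⊆G⁺) | no t≢D   = inj₂ (part j (𝓑t , t⊆G⁺ , λ _ → t≢D))
    merge : 𝒯 t ⊎ Parts → 𝓑 t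
    merge (inj₁ 𝒯t)                     = 𝒯⊑𝓑 t 𝒯t
    merge (inj₂ (inj₁ (𝓑t , _)))        = 𝓑t
    merge (inj₂ (inj₂ (inj₁ (𝓑t , _)))) = 𝓑t
    merge (inj₂ (inj₂ (inj₂ (𝓑t , _)))) = 𝓑t

  w+3-mod6 : ∀ {i} → AbsorbsD i → (w + 3) % 6 ≡ 1 ⊎ (w + 3) % 6 ≡ 3
  w+3-mod6 {i} absorbs = subst (λ v → v % 6 ≡ 1 ⊎ v % 6 ≡ 3) (∣G⁺∣≡ i)
    (SteinerTripleSystem.order-mod6 (proj₂ (Part-SubSTS absorbs)) (D⊆G⁺ i (proj₂ point-of-D)))

  Decomposition : Set₁
  Decomposition = Σ (Coll n) λ 𝓑A → Σ (Coll n) λ 𝓑B → Σ (Coll n) λ 𝓑C →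
    IsUnion4 𝓑 𝒯 𝓑A 𝓑B 𝓑C ×
    ((AlmostSubSTS 𝓑 (A ∪ D) D 𝓑A × AlmostSubSTS 𝓑 (B ∪ D) D 𝓑B × SubSTS 𝓑 (C ∪ D) 𝓑C)
     ⊎ (AlmostSubSTS 𝓑 (A ∪ D) D 𝓑A × SubSTS 𝓑 (B ∪ D) 𝓑B × AlmostSubSTS 𝓑 (C ∪ D) D 𝓑C)
     ⊎ (SubSTS 𝓑 (A ∪ D) 𝓑A × AlmostSubSTS 𝓑 (B ∪ D) D 𝓑B × AlmostSubSTS 𝓑 (C ∪ D) D 𝓑C))

  decomposition : ∀ i → AbsorbsD i → Decomposition
  decomposition i@zero absorbs =
    Part i zero , Part i (suc zero) , Part i (suc (suc zero)) , Part-union i ,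
    inj₂ (inj₂ (Part-SubSTS absorbs , Part-AlmostSubSTS absorbs (λ ()) , Part-AlmostSubSTS absorbs (λ ())))
  decomposition i@(suc zero) absorbs =
    Part i zero , Part i (suc zero) , Part i (suc (suc zero)) , Part-union i ,
    inj₂ (inj₁ (Part-AlmostSubSTS absorbs (λ ()) , Part-SubSTS absorbs , Part-AlmostSubSTS absorbs (λ ())))
  decomposition i@(suc (suc zero)) absorbs =
    Part i zero , Part i (suc zero) , Part i (suc (suc zero)) , Part-union i ,
    inj₁ (Part-AlmostSubSTS absorbs (λ ()) , Part-AlmostSubSTS absorbs (λ ()) , Part-SubSTS absorbs)

lemma1 : (w n : ℕ) → 1 ≤ w → (A B C D : Subset n) →
    A ∩ B ≡ ⊥ → A ∩ C ≡ ⊥ → A ∩ D ≡ ⊥ → B ∩ C ≡ ⊥ → B ∩ D ≡ ⊥ → C ∩ D ≡ ⊥ →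
    ∣ A ∣ ≡ w → ∣ B ∣ ≡ w → ∣ C ∣ ≡ w → ∣ D ∣ ≡ 3 →
    (𝓑 𝒯 : Coll n) →
    IsSTS (A ∪ B ∪ C ∪ D) 𝓑 →
    𝒯 ⊑ 𝓑 → IsTD3 w (groups A B C) 𝒯 →
    Σ (Coll n) (λ 𝓑A → Σ (Coll n) (λ 𝓑B → Σ (Coll n) (λ 𝓑C →
      IsUnion4 𝓑 𝒯 𝓑A 𝓑B 𝓑C ×
      ((AlmostSubSTS 𝓑 (A ∪ D) D 𝓑A × AlmostSubSTS 𝓑 (B ∪ D) D 𝓑B × SubSTS 𝓑 (C ∪ D) 𝓑C)
       ⊎ (AlmostSubSTS 𝓑 (A ∪ D) D 𝓑A × SubSTS 𝓑 (B ∪ D) 𝓑B × AlmostSubSTS 𝓑 (C ∪ D) D 𝓑C)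
       ⊎ (SubSTS 𝓑 (A ∪ D) 𝓑A × AlmostSubSTS 𝓑 (B ∪ D) D 𝓑B × AlmostSubSTS 𝓑 (C ∪ D) D 𝓑C)))))
    × ((w + 3) % 6 ≡ 1 ⊎ (w + 3) % 6 ≡ 3)
lemma1 w n _ A B C D A∩B≡⊥ A∩C≡⊥ A∩D≡⊥ B∩C≡⊥ B∩D≡⊥ C∩D≡⊥ ∣A∣≡w ∣B∣≡w ∣C∣≡w ∣D∣≡3 𝓑 𝒯 sts 𝒯⊑𝓑 td =
  let i , absorbs = some-G⁺-absorbs-D in decomposition i absorbs , w+3-mod6 absorbs
  where
  open Configuration w n A B C D A∩B≡⊥ A∩C≡⊥ A∩D≡⊥ B∩C≡⊥ B∩D≡⊥ C∩D≡⊥ ∣A∣≡w ∣B∣≡w ∣C∣≡w ∣D∣≡3 𝓑 𝒯 sts 𝒯⊑𝓑 td
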